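{- Let $\mathcal{C}$ be a finite inverse category. Then every Reedy fibrant functor $X : \mathcal{C} \to \mathcal{U}$ has a fibrant limit.
   Context: We work internally in a two-level type theory: there are fibrant types (with fibrant universe $\mathcal{U}$ and fibrant equality $=$) and strict types (with strict universe $\mathcal{U}^{\mathrm{s}}$ and strict equality $=_{\mathrm{s}}$, satisfying UIP and function extensionality), every fibrant type coercing to a strict type. Categories are strict categories (category laws hold up to strict equality). A category is finite if its type of objects is strictly isomorphic to a strict finite ordinal $\mathsf{Fin}^{\mathrm{s}}(n)$ for some strict natural number $n$. A category $\mathcal{C}$ is an inverse category if there is a functor $\varphi : \mathcal{C} \to (\mathbb{N}^{\mathrm{s}})^{\mathrm{op}}$ (where $(\mathbb{N}^{\mathrm{s}})^{\mathrm{op}}(n,m) :\equiv n >^{\mathrm{s}} m$) which creates identities: if $f : \mathcal{C}(x,y)$ and $\varphi_x =_{\mathrm{s}} \varphi_y$, then $x =_{\mathrm{s}} y$ and $f$ is (transported to) the identity. For an object $z$, the reduced coslice $z /\!\!/ \mathcal{C}$ is the full subcategory of the coslice $z/\mathcal{C}$ on the non-identity arrows out of $z$, with forgetful functor $\mathsf{forget} : z /\!\!/ \mathcal{C} \to \mathcal{C}$. For $X : \mathcal{C} \to \mathcal{U}$, the matching object $M^X_z$ is the (strict, not necessarily fibrant) limit of $z /\!\!/ \mathcal{C} \xrightarrow{\mathsf{forget}} \mathcal{C} \xrightarrow{X} \mathcal{U} \subset \mathcal{U}^{\mathrm{s}}$. A map $p : E \to B$ is a fibration if there is $F : B \to \mathcal{U}$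 with each fibre of $p$ over $b$ strictly isomorphic to $F(b)$. $X$ is Reedy fibrant if for all $z$ the canonical map $X_z \to M^X_z$ is a fibration. $X$ has a fibrant limit if its limit in $\mathcal{U}^{\mathrm{s}}$ (the type of natural transformations from the constant functor $1$ to $X$) is strictly isomorphic to a fibrant type. -}

module Defs where

-- Two-level type theory, modelled inside Agda (K is on by default, so Agda's
-- Set with _≡_ is the STRICT layer: strict universe Uˢ = Set, strict equality
-- =ₛ = _≡_, UIP holds by K; strict function extensionality is assumed as a
-- hypothesis of the theorem).  The FIBRANT layer is an abstract universe
-- (U , El) whose codes coerce to strict types via El, closed under the
-- fibrant type formers 1, Σ, Π (up to strict isomorphism).

open import Data.Nat using (ℕ; _≤_)
open import Data.Fin using (Fin)
open import Data.Unit using (⊤; tt)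
open import Data.Product using (Σ; _,_; proj₁; proj₂)
open import Relation.Nullary using (¬_)
open import Relation.Binary.PropositionalEquality
  using (_≡_; refl; sym; trans; cong; subst)
open import Function.Bundles using (_↔_)

record FibrantUniverse : Set₁ where
  field
    U   : Set
    El  : U → Set
    ⊤ᶠ  : U
    Σᶠ  : (A : U) → (El A → U) → U
    Πᶠ  : (A : U) → (El A → U) → U
    El-⊤ : El ⊤ᶠ ↔ ⊤
    El-Σ : ∀ A B → El (Σᶠ A B) ↔ Σ (El A) (λ a → El (B a))
    El-Π : ∀ A B → El (Πᶠ A B) ↔ ((a : El A) → El (B a))

record Category : Set₁ where
  field
    Obj : Set
    Hom : Obj → Obj → Set
    id  : ∀ x → Hom x x
    _∘_ : ∀ {x y z} → Hom y z → Hom x y → Hom x z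
    idˡ : ∀ {x y} (f : Hom x y) → (id y ∘ f) ≡ f
    idʳ : ∀ {x y} (f : Hom x y) → (f ∘ id x) ≡ f
    assoc : ∀ {w x y z} (h : Hom y z) (g : Hom x y) (f : Hom w x) →
            ((h ∘ g) ∘ f) ≡ (h ∘ (g ∘ f))

record Functor (C D : Category) : Set where
  private
    module C = Category C
    module D = Category D
  field
    F₀ : C.Obj → D.Obj
    F₁ : ∀ {x y} → C.Hom x y → D.Hom (F₀ x) (F₀ y)
    F-id : ∀ x → F₁ (C.id x) ≡ D.id (F₀ x)
    F-∘  : ∀ {x y z} (g : C.Hom y z) (f : C.Hom x y) →
           F₁ (C._∘_ g f) ≡ D._∘_ (F₁ g) (F₁ f)

ℕᵒᵖ : Category
ℕᵒᵖ = record
  { Obj = ℕ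
  ; Hom = λ n m → m ≤ n
  ; id = λ n → ≤-refl
  ; _∘_ = λ g f → ≤-trans g f
  ; idˡ = λ f → ≤-irrelevant _ _
  ; idʳ = λ f → ≤-irrelevant _ _
  ; assoc = λ h g f → ≤-irrelevant _ _
  }
  where open import Data.Nat.Properties using (≤-refl; ≤-trans; ≤-irrelevant)

module _ (C : Category) where
  open Category C

  IsFinite : Set
  IsFinite = Σ ℕ (λ n → Obj ↔ Fin n)

  IsIdentity : ∀ {x y} → Hom x y → Set
  IsIdentity {x} {y} f = Σ (x ≡ y) (λ e → subst (Hom x) (sym e) f ≡ id x)

  CreatesIdentities : Functor C ℕᵒᵖ → Set
  CreatesIdentities φ = ∀ {x y} (f : Hom x y) →
    Functor.F₀ φ x ≡ Functor.F₀ φ y → IsIdentity f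

  IsInverse : Set
  IsInverse = Σ (Functor C ℕᵒᵖ) CreatesIdentities

private
  Σ-≡ : ∀ {A : Set} {B : A → Set} {a a' : A} {b : B a} {b' : B a'} →
        (e : a ≡ a') → subst B e b ≡ b' → (a , b) ≡ (a' , b')
  Σ-≡ refl refl = refl

  uip : ∀ {A : Set} {a b : A} (p q : a ≡ b) → p ≡ q
  uip refl refl = refl

module _ (C : Category) (z : Category.Obj C) where
  open Category C

  RCObj : Set
  RCObj = Σ Obj (λ y → Σ (Hom z y) (λ f → ¬ IsIdentity C f))

  RCHom : RCObj → RCObj → Set
  RCHom (y , f , _) (y' , f' , _) = Σ (Hom y y') (λ g → (g ∘ f) ≡ f')

  ReducedCoslice : Category
  ReducedCoslice = record
    { Obj = RCObj
    ; Hom = RCHom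
    ; id = λ { (y , f , _) → id y , idˡ f }
    ; _∘_ = λ { {_ , f , _} (h , q) (g , p) →
                (h ∘ g) , trans (assoc h g f) (trans (cong (h ∘_) p) q) }
    ; idˡ = λ f → Σ-≡ (idˡ (proj₁ f)) (uip _ _)
    ; idʳ = λ f → Σ-≡ (idʳ (proj₁ f)) (uip _ _)
    ; assoc = λ h g f → Σ-≡ (assoc (proj₁ h) (proj₁ g) (proj₁ f)) (uip _ _)
    }

  forget : Functor ReducedCoslice C
  forget = record
    { F₀ = proj₁
    ; F₁ = proj₁
    ; F-id = λ _ → refl
    ; F-∘ = λ _ _ → refl
    }

record Diagram (C : Category) : Set₁ where
  open Category C
  field
    D₀ : Obj → Set
    D₁ : ∀ {x y} → Hom x y → D₀ x → D₀ y
    D-id : ∀ x (a : D₀ x) → D₁ (id x) a ≡ a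
    D-∘  : ∀ {x y z} (g : Hom y z) (f : Hom x y) (a : D₀ x) →
           D₁ (g ∘ f) a ≡ D₁ g (D₁ f a)

_∘D_ : ∀ {B C} → Diagram C → Functor B C → Diagram B
D ∘D F = record
  { D₀ = λ x → D₀ (F₀ x)
  ; D₁ = λ f → D₁ (F₁ f)
  ; D-id = λ x a → trans (cong (λ h → D₁ h a) (F-id x)) (D-id _ a)
  ; D-∘ = λ g f a → trans (cong (λ h → D₁ h a) (F-∘ g f)) (D-∘ _ _ a)
  }
  where open Diagram D
        open Functor F

constD : (C : Category) → Set → Diagram C
constD C A = record
  { D₀ = λ _ → A ; D₁ = λ _ a → a ; D-id = λ _ _ → refl ; D-∘ = λ _ _ _ → refl }

record NatTrans {C : Category} (D E : Diagram C) : Set where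
  open Category C
  field
    η : ∀ x → Diagram.D₀ D x → Diagram.D₀ E x
    natural : ∀ {x y} (f : Hom x y) (a : Diagram.D₀ D x) →
              η y (Diagram.D₁ D f a) ≡ Diagram.D₁ E f (η x a)

Lim : ∀ {C} → Diagram C → Set
Lim {C} D = NatTrans (constD C ⊤) D

module _ (𝓤 : FibrantUniverse) where
  open FibrantUniverse 𝓤

  record FibDiagram (C : Category) : Set₁ where
    open Category C
    field
      X₀ : Obj → U
      X₁ : ∀ {x y} → Hom x y → El (X₀ x) → El (X₀ y)
      X-id : ∀ x (a : El (X₀ x)) → X₁ (id x) a ≡ a
      X-∘  : ∀ {x y z} (g : Hom y z) (f : Hom x y) (a : El (X₀ x)) →
             X₁ (g ∘ f) a ≡ X₁ g (X₁ f a)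

  toDiagram : ∀ {C} → FibDiagram C → Diagram C
  toDiagram X = record { D₀ = λ x → El (X₀ x) ; D₁ = X₁ ; D-id = X-id ; D-∘ = X-∘ }
    where open FibDiagram X

  fibre : {E B : Set} → (E → B) → B → Set
  fibre {E} p b = Σ E (λ e → p e ≡ b)

  IsFibration : {E B : Set} → (E → B) → Set
  IsFibration {E} {B} p = Σ (B → U) (λ F → ∀ b → fibre p b ↔ El (F b))

  module _ {C : Category} (X : FibDiagram C) where
    open Category C
    open FibDiagram X

    MatchingObject : Obj → Set
    MatchingObject z = Lim (toDiagram X ∘D forget C z)

    matchingMap : (z : Obj) → El (X₀ z) → MatchingObject z
    matchingMap z a = record
      { η = λ { (y , f , _) _ → X₁ f a }
      ; natural = λ { {_ , f , _} (g , p) _ →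
          trans (cong (λ h → X₁ h a) (sym p)) (X-∘ g f a) }
      }

    ReedyFibrant : Set
    ReedyFibrant = ∀ z → IsFibration (matchingMap z)

    HasFibrantLimit : Set
    HasFibrantLimit = Σ U (λ A → Lim (toDiagram X) ↔ El A)

module Submission where

-- Enumerate the objects of C so that every non-identity arrow goes
-- from a later object to an earlier one, and build the limit one object at
-- a time.  For a predicate P on objects, a "partial cone" over P is a
-- compatible family of elements of X x for the objects x in P.  If z is a
-- new object such that no arrow from P reaches z, every non-identity arrow
-- out of z lands in P and z has no non-trivial endomorphisms, then a
-- partial cone over P ∪ {z} is exactly a partial cone c over P together
-- with a point of the fibre of the matching map  X z → M z  over the
-- restriction of c to the reduced coslice z // C.  Reedy fibrancy makes
-- that fibre fibrant, so fibrancy of partial cones propagates from P to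
-- P ∪ {z} by a fibrant Σ-type.

open import Defs
open import Level using (0ℓ)
open import Axiom.Extensionality.Propositional
  using (Extensionality; implicit-extensionality)
open import Data.Nat using (ℕ; zero; suc; _<_; _≤_; _*_; _⊔_; _≟_)
open import Data.Nat.Properties
  using (<-irrefl; ≤-refl; <⇒≤; n<1+n; ≤-<-trans; <-≤-trans; m≤n⇒m<n∨m≡n;
         m<n⇒m<1+n; m<1+n⇒m<n∨m≡n; m≤m⊔n; m≤n⊔m)
open import Data.Fin using (Fin; toℕ; fromℕ<; combine)
open import Data.Fin.Properties
  using (toℕ<n; toℕ-injective; toℕ-fromℕ<; combine-monoˡ-<;
         combine-injectiveʳ; any?)
open import Data.Unit using (⊤; tt)
open import Data.Empty using (⊥; ⊥-elim)
open import Data.Sum using (_⊎_; inj₁; inj₂)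
open import Data.Product using (Σ; ∃-syntax; _,_; proj₁; proj₂)
open import Data.Product.Function.Dependent.Propositional using (Σ-↔)
open import Function.Bundles using (_↔_; Inverse; mk↔ₛ′)
open import Function.Properties.Inverse using (↔-sym; ↔-trans)
open import Relation.Binary.PropositionalEquality
open import Relation.Nullary using (¬_; yes; no)

uip : ∀ {A : Set} {a b : A} (p q : a ≡ b) → p ≡ q
uip refl refl = refl

bounded : ∀ {n} (g : Fin n → ℕ) → ∃[ B ] (∀ i → g i < B)
bounded {zero} g = 0 , λ ()
bounded {suc n} g with bounded (λ i → g (Fin.suc i))
... | B , below = suc (g Fin.zero) ⊔ B , λ
  { Fin.zero → m≤m⊔n (suc (g Fin.zero)) B
  ; (Fin.suc i) → <-≤-trans (below i) (m≤n⊔m (suc (g Fin.zero)) B) }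

NatTrans-≡ : Extensionality 0ℓ 0ℓ → ∀ {B : Category} {D E : Diagram B}
             (α β : NatTrans D E) →
             (∀ x a → NatTrans.η α x a ≡ NatTrans.η β x a) → α ≡ β
NatTrans-≡ ext {B} {D} {E} α β same =
  components (ext λ x → ext λ a → same x a) (NatTrans.natural α) (NatTrans.natural β)
  where
  open Diagram
  Naturality : (∀ x → D₀ D x → D₀ E x) → Set
  Naturality η = ∀ {x y} (f : Category.Hom B x y) (a : D₀ D x) →
                 η y (D₁ D f a) ≡ D₁ E f (η x a)
  components : ∀ {η₁ η₂} → η₁ ≡ η₂ → (n₁ : Naturality η₁) (n₂ : Naturality η₂) →
               _≡_ {A = NatTrans D E} (record { η = η₁ ; natural = n₁ })
                                      (record { η = η₂ ; natural = n₂ })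
  components {η₁} refl n₁ n₂ = cong (λ (n : Naturality η₁) → record { η = η₁ ; natural = n })
    (implicit-extensionality ext (implicit-extensionality ext
      (ext λ f → ext λ a → uip (n₁ f a) (n₂ f a))))

-- Partial cones of a strict diagram D over a predicate P on objects: the
-- limit of D restricted to the full subcategory on P.
module PartialCones (ext : Extensionality 0ℓ 0ℓ) {C : Category} (D : Diagram C) where
  open Category C
  open Diagram D

  record PartialCone (P : Obj → Set) : Set where
    constructor partialCone
    field
      η : ∀ x → P x → D₀ x
      natural : ∀ {x y} (f : Hom x y) (p : P x) (q : P y) → η y q ≡ D₁ f (η x p)
  open PartialCone public

  -- A component does not depend on the membership proof (naturality at id).
  η-irrelevant : ∀ {P} (c : PartialCone P) {x} (p q : P x) → η c x p ≡ η c x q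
  η-irrelevant c {x} p q = trans (natural c (id x) q p) (D-id x (η c x q))

  PartialCone-≡ : ∀ {P} (c d : PartialCone P) → (∀ x p → η c x p ≡ η d x p) → c ≡ d
  PartialCone-≡ (partialCone η₁ n₁) (partialCone η₂ n₂) same
    with ext (λ x → ext (λ p → same x p))
  ... | refl = cong (partialCone η₁) (implicit-extensionality ext
                 (implicit-extensionality ext
                   (ext λ f → ext λ p → ext λ q → uip (n₁ f p q) (n₂ f p q))))

  restrict : ∀ {P Q} → (∀ x → Q x → P x) → PartialCone P → PartialCone Q
  restrict Q⊆P c = partialCone (λ x q → η c x (Q⊆P x q))
                               (λ f p q → natural c f (Q⊆P _ p) (Q⊆P _ q))

  PartialCone-cong : ∀ {P Q} → (∀ x → P x → Q x) → (∀ x → Q x → P x) →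
                     PartialCone P ↔ PartialCone Q
  PartialCone-cong P⊆Q Q⊆P = mk↔ₛ′ (restrict Q⊆P) (restrict P⊆Q)
    (λ c → PartialCone-≡ _ _ (λ x q → η-irrelevant c _ q))
    (λ c → PartialCone-≡ _ _ (λ x p → η-irrelevant c _ p))

  PartialCone-empty : ∀ {P} → (∀ x → ¬ P x) → PartialCone P ↔ ⊤
  PartialCone-empty none = mk↔ₛ′ (λ _ → tt)
    (λ _ → partialCone (λ x p → ⊥-elim (none x p)) (λ f p → ⊥-elim (none _ p)))
    (λ _ → refl)
    (λ c → PartialCone-≡ _ _ (λ x p → ⊥-elim (none x p)))

  PartialCone-total : ∀ {P} → (∀ x → P x) → PartialCone P ↔ Lim D
  PartialCone-total all =
    ↔-trans (PartialCone-cong (λ _ _ → tt) (λ x _ → all x))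
      (mk↔ₛ′ (λ c → record { η = η c ; natural = λ f a → natural c f a a })
             (λ L → partialCone (NatTrans.η L) (λ f p q → NatTrans.natural L f p))
             (λ _ → refl) (λ _ → refl))

module FibrantPartialCones (𝓤 : FibrantUniverse) (ext : Extensionality 0ℓ 0ℓ)
                           {C : Category} (X : FibDiagram 𝓤 C) where
  open FibrantUniverse 𝓤
  open Category C
  open FibDiagram X
  open PartialCones ext (toDiagram 𝓤 X) public

  FibrantCones : (Obj → Set) → Set
  FibrantCones P = Σ U (λ A → PartialCone P ↔ El A)

  fibrant-cong : ∀ {P Q} → (∀ x → P x → Q x) → (∀ x → Q x → P x) →
                 FibrantCones P → FibrantCones Q
  fibrant-cong P⊆Q Q⊆P (A , cones≅A) =
    A , ↔-trans (PartialCone-cong Q⊆P P⊆Q) cones≅A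

  fibrant-empty : ∀ {P} → (∀ x → ¬ P x) → FibrantCones P
  fibrant-empty none = ⊤ᶠ , ↔-trans (PartialCone-empty none) (↔-sym El-⊤)

  Adjoin : (Obj → Set) → Obj → Obj → Set
  Adjoin P z x = P x ⊎ x ≡ z

  module Extension (P : Obj → Set) (z : Obj)
                   (no-arrow-in : ∀ {x} → P x → Hom x z → ⊥)
                   (arrows-out : ∀ {y} (f : Hom z y) → ¬ IsIdentity C f → P y)
                   (endo-id : (f : Hom z z) → f ≡ id z) where

    Matching : Set
    Matching = MatchingObject 𝓤 X z

    matching : El (X₀ z) → Matching
    matching = matchingMap 𝓤 X z

    toMatching : PartialCone P → Matching
    toMatching c = record
      { η = λ { (y , f , nid) _ → η c y (arrows-out f nid) }
      ; natural = λ { (g , _) _ → natural c g _ _ } }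

    Decomposed : Set
    Decomposed = Σ (PartialCone P) (λ c → fibre 𝓤 matching (toMatching c))

    -- Restrict to P and read off the component at z; naturality at the
    -- arrows out of z says that this component lies over the matching point.
    decompose : PartialCone (Adjoin P z) → Decomposed
    decompose c = restrict (λ _ → inj₁) c , η c z (inj₂ refl) ,
      NatTrans-≡ ext _ _ (λ { (y , f , nid) tt →
        sym (natural c f (inj₂ refl) (inj₁ (arrows-out f nid))) })

    -- z is genuinely new: its identity would be an arrow from P to z.
    z∉P : ¬ P z
    z∉P p = no-arrow-in p (id z)

    module Assemble (c : PartialCone P) (a : El (X₀ z))
                    (a-matches : matching a ≡ toMatching c) where
      component : ∀ x → Adjoin P z x → El (X₀ x)
      component x (inj₁ p) = η c x p
      component .z (inj₂ refl) = a

      -- Along an arrow z → y with y ∈ P the equation is the fibre condition.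
      from-z : ∀ {y} (f : Hom z y) (q : P y) → η c y q ≡ X₁ f a
      from-z {y} f q = begin
        η c y q                                     ≡⟨ η-irrelevant c q (arrows-out f nid) ⟩
        NatTrans.η (toMatching c) (y , f , nid) tt  ≡⟨ cong (component-at (y , f , nid)) a-matches ⟨
        X₁ f a                                      ∎
        where
        open ≡-Reasoning
        component-at : ∀ w → Matching → El (X₀ (proj₁ w))
        component-at w m = NatTrans.η m w tt
        nid : ¬ IsIdentity C f
        nid (refl , _) = z∉P q

      component-natural : ∀ {x y} (f : Hom x y) p q →
                          component y q ≡ X₁ f (component x p)
      component-natural f (inj₁ p) (inj₁ q) = natural c f p q
      component-natural f (inj₁ p) (inj₂ refl) = ⊥-elim (no-arrow-in p f)
      component-natural f (inj₂ refl) (inj₁ q) = from-z f q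
      component-natural f (inj₂ refl) (inj₂ refl) =
        sym (trans (cong (λ g → X₁ g a) (endo-id f)) (X-id z a))

      assembled : PartialCone (Adjoin P z)
      assembled = partialCone component component-natural

    assemble : Decomposed → PartialCone (Adjoin P z)
    assemble (c , a , a-matches) = Assemble.assembled c a a-matches

    extension-iso : PartialCone (Adjoin P z) ↔ Decomposed
    extension-iso = mk↔ₛ′ decompose assemble
      (λ { (c , a , e) → cong (λ e′ → c , a , e′) (uip _ e) })
      (λ c → PartialCone-≡ _ _ λ { x (inj₁ p) → refl ; x (inj₂ refl) → refl })

    extension-fibrant : IsFibration 𝓤 matching → FibrantCones P →
                        FibrantCones (Adjoin P z)
    extension-fibrant (F , fibre≅F) (A , cones≅A) =
      Σᶠ A (λ a → F (toMatching (Inverse.from cones≅A a))) ,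
      ↔-trans extension-iso
        (↔-trans (↔-sym (Σ-↔ (↔-sym cones≅A) (↔-sym (fibre≅F _))))
                 (↔-sym (El-Σ _ _)))

module Rank (C : Category) (n : ℕ) (fin : Category.Obj C ↔ Fin n)
            (φ : Functor C ℕᵒᵖ) (creates : CreatesIdentities C φ) where
  open Category C

  degree : Obj → ℕ
  degree = Functor.F₀ φ

  index : Obj → Fin n
  index = Inverse.to fin

  index-injective : ∀ {x y} → index x ≡ index y → x ≡ y
  index-injective {x} {y} e = begin
    x                          ≡⟨ Inverse.strictlyInverseʳ fin x ⟨
    Inverse.from fin (index x) ≡⟨ cong (Inverse.from fin) e ⟩
    Inverse.from fin (index y) ≡⟨ Inverse.strictlyInverseʳ fin y ⟩
    y                          ∎
    where open ≡-Reasoning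

  -- Arrows do not raise the degree, and keeping it means being an identity.
  lowers-degree : ∀ {x y} (f : Hom x y) → ¬ IsIdentity C f → degree y < degree x
  lowers-degree f nid with m≤n⇒m<n∨m≡n (Functor.F₁ φ f)
  ... | inj₁ lower = lower
  ... | inj₂ same = ⊥-elim (nid (creates f (sym same)))

  endo-id : ∀ {z} (f : Hom z z) → f ≡ id z
  endo-id f with creates f refl
  ... | refl , is-id = is-id

  B : ℕ
  B = proj₁ (bounded (λ i → degree (Inverse.from fin i)))

  degree-bound : ∀ x → degree x < B
  degree-bound x = subst (λ w → degree w < B) (Inverse.strictlyInverseʳ fin x)
    (proj₂ (bounded (λ i → degree (Inverse.from fin i))) (index x))

  bounded-degree : Obj → Fin B
  bounded-degree x = fromℕ< (degree-bound x)

  -- Lexicographic rank: degree first, then index.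
  rank : Obj → ℕ
  rank x = toℕ (combine (bounded-degree x) (index x))

  rank-bound : ∀ x → rank x < B * n
  rank-bound x = toℕ<n (combine (bounded-degree x) (index x))

  rank-injective : ∀ {x y} → rank x ≡ rank y → x ≡ y
  rank-injective {x} {y} e = index-injective
    (combine-injectiveʳ (bounded-degree x) (index x) (bounded-degree y) (index y)
                        (toℕ-injective e))

  lowers-rank : ∀ {x y} (f : Hom x y) → ¬ IsIdentity C f → rank y < rank x
  lowers-rank {x} {y} f nid = combine-monoˡ-< (index y) (index x)
    (subst₂ _<_ (sym (toℕ-fromℕ< (degree-bound y))) (sym (toℕ-fromℕ< (degree-bound x)))
            (lowers-degree f nid))

  rank-antitone : ∀ {x y} → Hom x y → rank y ≤ rank x
  rank-antitone f with m≤n⇒m<n∨m≡n (Functor.F₁ φ f)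
  ... | inj₁ lower = <⇒≤ (lowers-rank f (λ { (refl , _) → <-irrefl refl lower }))
  ... | inj₂ same with creates f (sym same)
  ...   | refl , _ = ≤-refl

module ReedyLimit (𝓤 : FibrantUniverse) (ext : Extensionality 0ℓ 0ℓ)
                  (C : Category) (n : ℕ) (fin : Category.Obj C ↔ Fin n)
                  (φ : Functor C ℕᵒᵖ) (creates : CreatesIdentities C φ)
                  (X : FibDiagram 𝓤 C) (reedy : ReedyFibrant 𝓤 X) where
  open Category C
  open Rank C n fin φ creates
  open FibrantPartialCones 𝓤 ext X

  Stage : ℕ → Obj → Set
  Stage m x = rank x < m

  -- The (at most one) object of rank m is adjoined to stage m.
  stage-step : ∀ m → FibrantCones (Stage m) → FibrantCones (Stage (suc m))
  stage-step m fib with any? (λ i → rank (Inverse.from fin i) ≟ m)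
  ... | no none = fibrant-cong (λ _ → m<n⇒m<1+n) shrink fib
    where
    shrink : ∀ x → Stage (suc m) x → Stage m x
    shrink x s with m<1+n⇒m<n∨m≡n s
    ... | inj₁ below = below
    ... | inj₂ at-m = ⊥-elim (none (index x ,
            trans (cong rank (Inverse.strictlyInverseʳ fin x)) at-m))
  ... | yes (i , rank-z) =
    fibrant-cong grow shrink
      (Extension.extension-fibrant (Stage m) z no-arrow-in arrows-out endo-id
         (reedy z) fib)
    where
    z : Obj
    z = Inverse.from fin i
    no-arrow-in : ∀ {x} → Stage m x → Hom x z → ⊥
    no-arrow-in s f = <-irrefl refl (≤-<-trans (subst (_≤ _) rank-z (rank-antitone f)) s)
    arrows-out : ∀ {y} (f : Hom z y) → ¬ IsIdentity C f → Stage m y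
    arrows-out f nid = subst (_ <_) rank-z (lowers-rank f nid)
    grow : ∀ x → Adjoin (Stage m) z x → Stage (suc m) x
    grow x (inj₁ s) = m<n⇒m<1+n s
    grow .z (inj₂ refl) = subst (_< suc m) (sym rank-z) (n<1+n m)
    shrink : ∀ x → Stage (suc m) x → Adjoin (Stage m) z x
    shrink x s with m<1+n⇒m<n∨m≡n s
    ... | inj₁ below = inj₁ below
    ... | inj₂ at-m = inj₂ (rank-injective (trans at-m (sym rank-z)))

  stage-fibrant : ∀ m → FibrantCones (Stage m)
  stage-fibrant zero = fibrant-empty (λ x ())
  stage-fibrant (suc m) = stage-step m (stage-fibrant m)

  limit-fibrant : HasFibrantLimit 𝓤 X
  limit-fibrant with stage-fibrant (B * n)
  ... | A , cones≅A = A , ↔-trans (↔-sym (PartialCone-total rank-bound)) cones≅A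

mainTheorem10 : (𝓤 : FibrantUniverse) → Extensionality Level.zero Level.zero →
    (C : Category) → IsFinite C → IsInverse C →
    (X : FibDiagram 𝓤 C) → ReedyFibrant 𝓤 X → HasFibrantLimit 𝓤 X
mainTheorem10 𝓤 ext C (n , fin) (φ , creates) X reedy =
  ReedyLimit.limit-fibrant 𝓤 ext C n fin φ creates X reedy
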